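{- For all integers $n,m\geq 0$ and any indeterminate $y$, \[ \sum_{k=0}^{n}\binom{n}{k}A_{m+k,m}(\mathbf{t})\,(y+1)^{k}(yt_1)^{n-k} = \sum_{k=0}^{n}\binom{n}{k}A_{n+m,m+k}(\mathbf{t})\,y^{k}. \]
   Context: $t_1,t_2,\dots$ are indeterminates. For a set partition $\pi$ assign each block of size $j$ the weight $t_j$, and let $w(\pi)$ be the product of its block weights. For $0\le k\le n$, $A_{n,k}(\mathbf{t})$ is the sum of $w(\pi)$ over all partitions of $[n+1]=\{1,\dots,n+1\}$ whose largest singleton block is $\{k+1\}$ (i.e. $\{k+1\}$ is a block and no $\{i\}$ with $i>k+1$ is a block). -}

module Defs where

open import Level using (Level)
open import Data.Nat using (ℕ; zero; suc; _≡ᵇ_; _≤ᵇ_)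
open import Data.Nat.Combinatorics using (_C_)
open import Data.Bool using (Bool; true; false; _∧_; if_then_else_)
open import Data.List using (List; []; _∷_; [_]; map; concatMap; length; upTo)
open import Data.Bool.ListAction using (any; all)
open import Algebra.Bundles using (CommutativeRing)

-- Set partitions of a finite list of (distinct) elements, as lists of
-- blocks.  Standard recursive enumeration: every set partition of
-- (x ∷ xs) arises uniquely from a set partition of xs, either by adding
-- the new singleton block {x}, or by inserting x into one existing block.

insertEach : ℕ → List (List ℕ) → List (List (List ℕ))
insertEach x []       = []
insertEach x (b ∷ bs) = ((x ∷ b) ∷ bs) ∷ map (b ∷_) (insertEach x bs)

setPartitions : List ℕ → List (List (List ℕ))
setPartitions []       = [] ∷ []
setPartitions (x ∷ xs) =
  concatMap (λ p → ([ x ] ∷ p) ∷ insertEach x p) (setPartitions xs)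

segment : ℕ → List ℕ
segment N = map suc (upTo N)

singletons : List (List ℕ) → List ℕ
singletons []                = []
singletons ([] ∷ p)          = singletons p
singletons ((i ∷ []) ∷ p)    = i ∷ singletons p
singletons ((i ∷ _ ∷ _) ∷ p) = singletons p

largestSingletonIs : ℕ → List (List ℕ) → Bool
largestSingletonIs s p =
  any (λ i → i ≡ᵇ s) (singletons p) ∧ all (λ i → i ≤ᵇ s) (singletons p)

-- Weighted sums, evaluated in an arbitrary commutative ring
-- (t : ℕ → R gives the values of t₁, t₂, … ; t 0 is never used).

module _ {c ℓ : Level} (R : CommutativeRing c ℓ) where
  open CommutativeRing R using (Carrier; _+_; _*_; 0#; 1#)

  _•_ : ℕ → Carrier → Carrier
  zero  • x = 0#
  suc n • x = x + (n • x)

  _^_ : Carrier → ℕ → Carrier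
  x ^ zero  = 1#
  x ^ suc n = x * (x ^ n)

  sumTo : ℕ → (ℕ → Carrier) → Carrier
  sumTo zero    f = f zero
  sumTo (suc n) f = sumTo n f + f (suc n)

  sumList : List Carrier → Carrier
  sumList []       = 0#
  sumList (x ∷ xs) = x + sumList xs

  weight : (ℕ → Carrier) → List (List ℕ) → Carrier
  weight t []       = 1#
  weight t (b ∷ bs) = t (length b) * weight t bs

  -- A_{n,k}(t): sum of w(π) over partitions π of [n+1] whose largest
  -- singleton block is {k+1}
  A : (ℕ → Carrier) → ℕ → ℕ → Carrier
  A t n k = sumList (map (λ p → if largestSingletonIs (suc k) p
                                  then weight t p else 0#)
                         (setPartitions (segment (suc n))))

module Submission where

-- Combinatorial half: A_{N+1,a+1} = A_{N+1,a} + t₁ A_{N,a} for a ≤ N.  With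
-- e = a+1 and σ = a+2, a partition of [N+2] with largest singleton σ either
-- has the block {e} (weight t₁ times a partition of [N+2] ∖ {e}, which after
-- closing the gap is counted by A_{N,a}) or has e in a larger block; exchanging
-- the labels e and σ matches the latter with the partitions counted by
-- A_{N+1,a}.
--
-- Algebraic half (module BinomialTransform): every F with
-- F(N+1,a+1) = F(N+1,a) + u F(N,a) satisfies, for a ≤ c and by induction on n,
--   Σₖ C(n,k) F(n+c,a+k) y^k = Σₖ C(n,k) F(c+k,a) (y+1)^k (y u)^{n-k};
-- the corollary is the case F = A, u = t₁, a = c = m.

open import Defs
open import Level using (Level)
open import Function.Base using (_∘_)
open import Function.Bundles using (Equivalence)
open import Data.Bool using (Bool; true; false; _∧_; _∨_; if_then_else_; T)
open import Data.Bool.Properties using (T-≡; ¬-not; ∧-zeroʳ; ∨-commutativeMonoid; ∧-commutativeMonoid)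
open import Data.Bool.ListAction using (any; all; and; or)
import Data.Nat as ℕ
open import Data.Nat using (ℕ; zero; suc; _∸_; _≡ᵇ_; _≤ᵇ_; _≤_; _<_; s≤s; z≤n)
open import Data.Nat.Properties using (<⇒≢; >⇒≢; n<1+n; ≡ᵇ⇒≡; ≡⇒≡ᵇ; ≤ᵇ⇒≤; ≤⇒≤ᵇ; ≤-refl; ≤-trans; n≤1+n; <⇒≤; <-trans; <⇒≱; ≰⇒>; _≤?_; m≤m+n; +-suc; +-∸-assoc; m+[n∸m]≡n) renaming (+-identityʳ to ℕ-+-identityʳ)
open import Data.Nat.Combinatorics using (_C_; nCk+nC[k+1]≡[n+1]C[k+1]; k>n⇒nCk≡0)
open import Data.List using (List; []; _∷_; [_]; _++_; map; concatMap; length; foldr; applyUpTo)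
open import Data.List.Properties using (map-++; map-∘; map-cong; map-cong-local; map-id-local; length-map)
open import Data.List.Relation.Unary.All as All using (All; []; _∷_)
open import Data.List.Relation.Unary.All.Properties using () renaming (++⁺ to All-++⁺)
open import Data.List.Relation.Binary.Permutation.Propositional using (_↭_; prep; swap; ↭-sym) renaming (refl to ↭-refl; trans to ↭-trans)
open import Data.List.Relation.Binary.Permutation.Propositional.Properties using (↭-length; ↭-singleton-inv; ++⁺ˡ; shift; shifts; map⁺)
import Data.Product as Product
open import Data.Product using (_,_; proj₁; proj₂)
open import Data.Unit using (⊤; tt)
open import Data.Empty using (⊥)
open import Relation.Nullary using (¬_; yes; no)
open import Relation.Binary.PropositionalEquality as P using (_≡_; _≢_)
open import Algebra.Bundles using (CommutativeRing; CommutativeMonoid)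
import Algebra.Properties.CommutativeSemigroup as CommutativeSemigroupProperties
import Algebra.Properties.Semiring.Mult as SemiringMult
import Algebra.Properties.CommutativeMonoid.Mult as CommutativeMonoidMult
import Relation.Binary.Reasoning.Setoid as SetoidReasoning

T⇒≡true : ∀ {b} → T b → b ≡ true
T⇒≡true = Equivalence.to T-≡

¬T⇒≡false : ∀ {b} → ¬ T b → b ≡ false
¬T⇒≡false ¬b = ¬-not (¬b ∘ Equivalence.from T-≡)

≡ᵇ-refl : ∀ n → (n ≡ᵇ n) ≡ true
≡ᵇ-refl n = T⇒≡true (≡⇒≡ᵇ n n P.refl)

≡ᵇ-false : ∀ {m n} → m ≢ n → (m ≡ᵇ n) ≡ false
≡ᵇ-false {m} {n} m≢n = ¬T⇒≡false (m≢n ∘ ≡ᵇ⇒≡ m n)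

≤ᵇ-true : ∀ {m n} → m ≤ n → (m ≤ᵇ n) ≡ true
≤ᵇ-true = T⇒≡true ∘ ≤⇒≤ᵇ

≤ᵇ-false : ∀ {m n} → n < m → (m ≤ᵇ n) ≡ false
≤ᵇ-false {m} {n} n<m = ¬T⇒≡false (<⇒≱ n<m ∘ ≤ᵇ⇒≤ m n)

≤ᵇ-suc : ∀ m n → (suc m ≤ᵇ suc n) ≡ (m ≤ᵇ n)
≤ᵇ-suc zero    n = P.refl
≤ᵇ-suc (suc m) n = P.refl

foldr-↭ : ∀ {A : Set} (_⊕_ : A → A → A) (ε : A) →
          (∀ x y z → x ⊕ (y ⊕ z) ≡ y ⊕ (x ⊕ z)) →
          ∀ {l l′} → l ↭ l′ → foldr _⊕_ ε l ≡ foldr _⊕_ ε l′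
foldr-↭ _⊕_ ε lcomm ↭-refl          = P.refl
foldr-↭ _⊕_ ε lcomm (prep x l↭l′)   = P.cong (x ⊕_) (foldr-↭ _⊕_ ε lcomm l↭l′)
foldr-↭ _⊕_ ε lcomm (swap x y l↭l′) =
  P.trans (P.cong (λ r → x ⊕ (y ⊕ r)) (foldr-↭ _⊕_ ε lcomm l↭l′)) (lcomm x y _)
foldr-↭ _⊕_ ε lcomm (↭-trans l↭l₁ l₁↭l′) =
  P.trans (foldr-↭ _⊕_ ε lcomm l↭l₁) (foldr-↭ _⊕_ ε lcomm l₁↭l′)

any-↭ : ∀ (Q : ℕ → Bool) {l l′} → l ↭ l′ → any Q l ≡ any Q l′
any-↭ Q l↭l′ = foldr-↭ _∨_ false x∙yz≈y∙xz (map⁺ Q l↭l′)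
  where open CommutativeSemigroupProperties (CommutativeMonoid.commutativeSemigroup ∨-commutativeMonoid)

all-↭ : ∀ (Q : ℕ → Bool) {l l′} → l ↭ l′ → all Q l ≡ all Q l′
all-↭ Q l↭l′ = foldr-↭ _∧_ true x∙yz≈y∙xz (map⁺ Q l↭l′)
  where open CommutativeSemigroupProperties (CommutativeMonoid.commutativeSemigroup ∧-commutativeMonoid)

range : ℕ → ℕ → List ℕ
range a zero    = []
range a (suc n) = suc a ∷ range (suc a) n

applyUpTo-range : ∀ (f : ℕ → ℕ) a n → (∀ i → f i ≡ a ℕ.+ i) → map suc (applyUpTo f n) ≡ range a n
applyUpTo-range f a zero    f≗a+ = P.refl
applyUpTo-range f a (suc n) f≗a+ =
  P.cong₂ _∷_ (P.cong suc (P.trans (f≗a+ 0) (ℕ-+-identityʳ a)))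
    (applyUpTo-range (f ∘ suc) (suc a) n (λ i → P.trans (f≗a+ (suc i)) (+-suc a i)))

segment≡range : ∀ n → segment n ≡ range 0 n
segment≡range n = applyUpTo-range (λ i → i) 0 n (λ i → P.refl)

range-++ : ∀ a m n → range a (m ℕ.+ n) ≡ range a m ++ range (a ℕ.+ m) n
range-++ a zero    n = P.cong (λ b → range b n) (P.sym (ℕ-+-identityʳ a))
range-++ a (suc m) n = P.cong (suc a ∷_)
  (P.trans (range-++ (suc a) m n) (P.cong (λ b → range (suc a) m ++ range b n) (P.sym (+-suc a m))))

range-All : ∀ (D : ℕ → Set) a n → (∀ i → a < i → i ≤ a ℕ.+ n → D i) → All D (range a n)
range-All D a zero    h = []
range-All D a (suc n) h =
  h (suc a) ≤-refl (P.subst (suc a ≤_) (P.sym (+-suc a n)) (s≤s (m≤m+n a n)))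
  ∷ range-All D (suc a) n (λ i a<i i≤ → h i (<⇒≤ a<i) (P.subst (i ≤_) (P.sym (+-suc a n)) i≤))

map-suc-range : ∀ a n → map suc (range a n) ≡ range (suc a) n
map-suc-range a zero    = P.refl
map-suc-range a (suc n) = P.cong (suc (suc a) ∷_) (map-suc-range (suc a) n)

-- Sums over set partitions only make sense for
-- summands that do not see such rearrangements.

Partition : Set
Partition = List (List ℕ)

data _~_ : Partition → Partition → Set where
  swapBlocks   : ∀ b c p → (b ∷ c ∷ p) ~ (c ∷ b ∷ p)
  permuteBlock : ∀ {b c} p → b ↭ c → (b ∷ p) ~ (c ∷ p)
  keepBlock    : ∀ b {p q} → p ~ q → (b ∷ p) ~ (b ∷ q)

singletonOf : List ℕ → List ℕ
singletonOf []          = []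
singletonOf (i ∷ [])    = i ∷ []
singletonOf (i ∷ _ ∷ _) = []

singletons-∷ : ∀ b p → singletons (b ∷ p) ≡ singletonOf b ++ singletons p
singletons-∷ []          p = P.refl
singletons-∷ (i ∷ [])    p = P.refl
singletons-∷ (i ∷ _ ∷ _) p = P.refl

-- whether a block is a singleton depends only on its size
singletonOf-↭ : ∀ {b c} → b ↭ c → singletonOf b ≡ singletonOf c
singletonOf-↭ {[]}        {[]}        _   = P.refl
singletonOf-↭ {[]}        {_ ∷ _}     b↭c with () ← ↭-length b↭c
singletonOf-↭ {i ∷ []}                b↭c rewrite ↭-singleton-inv (↭-sym b↭c) = P.refl
singletonOf-↭ {_ ∷ _ ∷ _} {[]}        b↭c with () ← ↭-length b↭c
singletonOf-↭ {_ ∷ _ ∷ _} {_ ∷ []}    b↭c with () ← ↭-length b↭c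
singletonOf-↭ {_ ∷ _ ∷ _} {_ ∷ _ ∷ _} _   = P.refl

singletons-~ : ∀ {p q} → p ~ q → singletons p ↭ singletons q
singletons-~ (swapBlocks b c p)
  rewrite singletons-∷ b (c ∷ p) | singletons-∷ c p | singletons-∷ c (b ∷ p) | singletons-∷ b p
  = shifts (singletonOf b) (singletonOf c)
singletons-~ (permuteBlock {b} {c} p b↭c)
  rewrite singletons-∷ b p | singletons-∷ c p | singletonOf-↭ b↭c = ↭-refl
singletons-~ (keepBlock b {p} {q} p~q)
  rewrite singletons-∷ b p | singletons-∷ b q = ++⁺ˡ (singletonOf b) (singletons-~ p~q)

relabel : (ℕ → ℕ) → Partition → Partition
relabel g = map (map g)

singletons-relabel : ∀ g p → singletons (relabel g p) ≡ map g (singletons p)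
singletons-relabel g []                  = P.refl
singletons-relabel g ([] ∷ p)            = singletons-relabel g p
singletons-relabel g ((i ∷ []) ∷ p)      = P.cong (g i ∷_) (singletons-relabel g p)
singletons-relabel g ((i ∷ _ ∷ _) ∷ p)   = singletons-relabel g p

AdmissibleBlock : (ℕ → Set) → List ℕ → Set
AdmissibleBlock D []          = ⊥
AdmissibleBlock D (i ∷ [])    = D i
AdmissibleBlock D (_ ∷ _ ∷ _) = ⊤

SingletonsIn : (ℕ → Set) → Partition → Set
SingletonsIn D = All (AdmissibleBlock D)

SingletonsIn⇒All : ∀ {D} p → SingletonsIn D p → All D (singletons p)
SingletonsIn⇒All []                []       = []
SingletonsIn⇒All ((i ∷ []) ∷ p)    (d ∷ h)  = d ∷ SingletonsIn⇒All p h
SingletonsIn⇒All ((_ ∷ _ ∷ _) ∷ p) (_ ∷ h)  = SingletonsIn⇒All p h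

Agree : (ℕ → Bool) → (ℕ → Bool) → (ℕ → Bool) → (ℕ → Bool) → ℕ → Set
Agree Q Q′ P P′ i = (Q i ≡ Q′ i) Product.× (P i ≡ P′ i)

module PartitionSums {c ℓ : Level} (R : CommutativeRing c ℓ) where
  open CommutativeRing R
  open SetoidReasoning setoid
  open CommutativeSemigroupProperties +-commutativeSemigroup using (interchange)

  sumOver : List Partition → (Partition → Carrier) → Carrier
  sumOver l f = sumList R (map f l)

  sumOver-cong : ∀ l {f g} → (∀ p → f p ≈ g p) → sumOver l f ≈ sumOver l g
  sumOver-cong []      f≈g = refl
  sumOver-cong (p ∷ l) f≈g = +-cong (f≈g p) (sumOver-cong l f≈g)

  sumOver-+ : ∀ l f g → sumOver l (λ p → f p + g p) ≈ sumOver l f + sumOver l g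
  sumOver-+ []      f g = sym (+-identityˡ 0#)
  sumOver-+ (p ∷ l) f g = trans (+-congˡ (sumOver-+ l f g)) (interchange _ _ _ _)

  sumOver-* : ∀ l a f → sumOver l (λ p → a * f p) ≈ a * sumOver l f
  sumOver-* []      a f = sym (zeroʳ a)
  sumOver-* (p ∷ l) a f = trans (+-congˡ (sumOver-* l a f)) (sym (distribˡ a (f p) (sumOver l f)))

  sumOver-++ : ∀ l l′ f → sumOver (l ++ l′) f ≈ sumOver l f + sumOver l′ f
  sumOver-++ []      l′ f = sym (+-identityˡ _)
  sumOver-++ (p ∷ l) l′ f = trans (+-congˡ (sumOver-++ l l′ f)) (sym (+-assoc _ _ _))

  sumOver-map : ∀ l (h : Partition → Partition) f → sumOver (map h l) f ≈ sumOver l (f ∘ h)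
  sumOver-map []      h f = refl
  sumOver-map (p ∷ l) h f = +-congˡ (sumOver-map l h f)

  sumOver-concatMap : ∀ l (g : Partition → List Partition) f →
                      sumOver (concatMap g l) f ≈ sumOver l (λ p → sumOver (g p) f)
  sumOver-concatMap []      g f = refl
  sumOver-concatMap (p ∷ l) g f =
    trans (sumOver-++ (g p) (concatMap g l) f) (+-congˡ (sumOver-concatMap l g f))

  Σpart : List ℕ → (Partition → Carrier) → Carrier
  Σpart xs f = sumOver (setPartitions xs) f

  Σinsert : ℕ → (Partition → Carrier) → Partition → Carrier
  Σinsert x f p = sumOver (insertEach x p) f

  -- the contribution of all partitions of x ∷ xs restricting to p on xs
  extend : ℕ → (Partition → Carrier) → Partition → Carrier
  extend x f p = f ([ x ] ∷ p) + Σinsert x f p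

  Σpart-∷ : ∀ x xs f → Σpart (x ∷ xs) f ≈ Σpart xs (extend x f)
  Σpart-∷ x xs f = sumOver-concatMap (setPartitions xs) _ f

  Σpart-cong : ∀ xs {f g} → (∀ p → f p ≈ g p) → Σpart xs f ≈ Σpart xs g
  Σpart-cong xs = sumOver-cong (setPartitions xs)

  Σinsert-∷ : ∀ x b p f → Σinsert x f (b ∷ p) ≈ f ((x ∷ b) ∷ p) + Σinsert x (λ q → f (b ∷ q)) p
  Σinsert-∷ x b p f = +-congˡ (sumOver-map (insertEach x p) (b ∷_) f)

  Σinsert-cong : ∀ x p {f g} → (∀ q → f q ≈ g q) → Σinsert x f p ≈ Σinsert x g p
  Σinsert-cong x p = sumOver-cong (insertEach x p)

  Σinsert-+ : ∀ x p f g → Σinsert x (λ q → f q + g q) p ≈ Σinsert x f p + Σinsert x g p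
  Σinsert-+ x p = sumOver-+ (insertEach x p)

  Invariant : (Partition → Carrier) → Set ℓ
  Invariant f = ∀ {p q} → p ~ q → f p ≈ f q

  Σinsert-invariant : ∀ x f → Invariant f → Invariant (Σinsert x f)
  Σinsert-invariant x f inv (swapBlocks b c p) = begin
    Σinsert x f (b ∷ c ∷ p)
      ≈⟨ trans (Σinsert-∷ x b (c ∷ p) f) (+-congˡ (Σinsert-∷ x c p _)) ⟩
    f ((x ∷ b) ∷ c ∷ p) + (f (b ∷ (x ∷ c) ∷ p) + Σinsert x (λ q → f (b ∷ c ∷ q)) p)
      ≈⟨ sym (+-assoc _ _ _) ⟩
    (f ((x ∷ b) ∷ c ∷ p) + f (b ∷ (x ∷ c) ∷ p)) + Σinsert x (λ q → f (b ∷ c ∷ q)) p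
      ≈⟨ +-cong (trans (+-comm _ _) (+-cong (inv (swapBlocks _ _ _)) (inv (swapBlocks _ _ _))))
                (Σinsert-cong x p (λ q → inv (swapBlocks _ _ _))) ⟩
    (f ((x ∷ c) ∷ b ∷ p) + f (c ∷ (x ∷ b) ∷ p)) + Σinsert x (λ q → f (c ∷ b ∷ q)) p
      ≈⟨ +-assoc _ _ _ ⟩
    f ((x ∷ c) ∷ b ∷ p) + (f (c ∷ (x ∷ b) ∷ p) + Σinsert x (λ q → f (c ∷ b ∷ q)) p)
      ≈⟨ sym (trans (Σinsert-∷ x c (b ∷ p) f) (+-congˡ (Σinsert-∷ x b p _))) ⟩
    Σinsert x f (c ∷ b ∷ p) ∎
  Σinsert-invariant x f inv (permuteBlock {b} {c} p b↭c) = begin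
    Σinsert x f (b ∷ p)                           ≈⟨ Σinsert-∷ x b p f ⟩
    f ((x ∷ b) ∷ p) + Σinsert x (λ q → f (b ∷ q)) p
      ≈⟨ +-cong (inv (permuteBlock p (prep x b↭c))) (Σinsert-cong x p (λ q → inv (permuteBlock q b↭c))) ⟩
    f ((x ∷ c) ∷ p) + Σinsert x (λ q → f (c ∷ q)) p ≈⟨ sym (Σinsert-∷ x c p f) ⟩
    Σinsert x f (c ∷ p)                           ∎
  Σinsert-invariant x f inv (keepBlock b {p} {q} p~q) = begin
    Σinsert x f (b ∷ p)                           ≈⟨ Σinsert-∷ x b p f ⟩
    f ((x ∷ b) ∷ p) + Σinsert x (λ r → f (b ∷ r)) p
      ≈⟨ +-cong (inv (keepBlock _ p~q)) (Σinsert-invariant x (λ r → f (b ∷ r)) (inv ∘ keepBlock b) p~q) ⟩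
    f ((x ∷ b) ∷ q) + Σinsert x (λ r → f (b ∷ r)) q ≈⟨ sym (Σinsert-∷ x b q f) ⟩
    Σinsert x f (b ∷ q)                           ∎

  extend-invariant : ∀ x f → Invariant f → Invariant (extend x f)
  extend-invariant x f inv p~q = +-cong (inv (keepBlock _ p~q)) (Σinsert-invariant x f inv p~q)

  -- Inserting x and then y into blocks gives the same partitions as
  -- inserting y and then x (up to reordering the elements of a block).
  Σinsert-comm : ∀ x y f → Invariant f → ∀ p → Σinsert y (Σinsert x f) p ≈ Σinsert x (Σinsert y f) p
  Σinsert-comm x y f inv []      = refl
  Σinsert-comm x y f inv (b ∷ p) = begin
    Σinsert y (Σinsert x f) (b ∷ p) ≈⟨ Σinsert-∷ y b p _ ⟩
    Σinsert x f ((y ∷ b) ∷ p) + Σinsert y (λ q → Σinsert x f (b ∷ q)) p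
      ≈⟨ +-cong (Σinsert-∷ x (y ∷ b) p f)
                (trans (Σinsert-cong y p (λ q → Σinsert-∷ x b q f)) (Σinsert-+ y p _ _)) ⟩
    (f ((x ∷ y ∷ b) ∷ p) + Σinsert x (λ q → f ((y ∷ b) ∷ q)) p)
      + (Σinsert y (λ q → f ((x ∷ b) ∷ q)) p + Σinsert y (Σinsert x (λ q → f (b ∷ q))) p)
      ≈⟨ interchange _ _ _ _ ⟩
    (f ((x ∷ y ∷ b) ∷ p) + Σinsert y (λ q → f ((x ∷ b) ∷ q)) p)
      + (Σinsert x (λ q → f ((y ∷ b) ∷ q)) p + Σinsert y (Σinsert x (λ q → f (b ∷ q))) p)
      ≈⟨ +-cong (+-congʳ (inv (permuteBlock p (swap x y ↭-refl))))
                (+-congˡ (Σinsert-comm x y (λ q → f (b ∷ q)) (inv ∘ keepBlock b) p)) ⟩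
    (f ((y ∷ x ∷ b) ∷ p) + Σinsert y (λ q → f ((x ∷ b) ∷ q)) p)
      + (Σinsert x (λ q → f ((y ∷ b) ∷ q)) p + Σinsert x (Σinsert y (λ q → f (b ∷ q))) p)
      ≈⟨ sym (+-cong (Σinsert-∷ y (x ∷ b) p f)
                     (trans (Σinsert-cong x p (λ q → Σinsert-∷ y b q f)) (Σinsert-+ x p _ _))) ⟩
    Σinsert y f ((x ∷ b) ∷ p) + Σinsert x (λ q → Σinsert y f (b ∷ q)) p ≈⟨ sym (Σinsert-∷ x b p _) ⟩
    Σinsert x (Σinsert y f) (b ∷ p) ∎

  extend-comm : ∀ x y f → Invariant f → ∀ p → extend y (extend x f) p ≈ extend x (extend y f) p
  extend-comm x y f inv p = begin
    extend x f ([ y ] ∷ p) + Σinsert y (extend x f) p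
      ≈⟨ +-cong (+-congˡ (Σinsert-∷ x [ y ] p f)) (Σinsert-+ y p _ _) ⟩
    (f ([ x ] ∷ [ y ] ∷ p) + (f ((x ∷ y ∷ []) ∷ p) + Σinsert x (λ q → f ([ y ] ∷ q)) p))
      + (Σinsert y (λ q → f ([ x ] ∷ q)) p + Σinsert y (Σinsert x f) p)
      ≈⟨ regroup (inv (swapBlocks _ _ _)) (inv (permuteBlock p (swap x y ↭-refl))) (Σinsert-comm x y f inv p) ⟩
    (f ([ y ] ∷ [ x ] ∷ p) + (f ((y ∷ x ∷ []) ∷ p) + Σinsert y (λ q → f ([ x ] ∷ q)) p))
      + (Σinsert x (λ q → f ([ y ] ∷ q)) p + Σinsert x (Σinsert y f) p)
      ≈⟨ sym (+-cong (+-congˡ (Σinsert-∷ y [ x ] p f)) (Σinsert-+ x p _ _)) ⟩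
    extend y f ([ x ] ∷ p) + Σinsert x (extend y f) p ∎
    where
    regroup : ∀ {a b c d e a′ b′ e′} → a ≈ a′ → b ≈ b′ → e ≈ e′ →
              (a + (b + c)) + (d + e) ≈ (a′ + (b′ + d)) + (c + e′)
    regroup {a} {b} {c} {d} {e} {a′} {b′} {e′} a≈ b≈ e≈ = begin
      (a + (b + c)) + (d + e) ≈⟨ +-congʳ (sym (+-assoc a b c)) ⟩
      ((a + b) + c) + (d + e) ≈⟨ interchange _ _ _ _ ⟩
      ((a + b) + d) + (c + e) ≈⟨ +-cong (trans (+-assoc a b d) (+-cong a≈ (+-congʳ b≈))) (+-congˡ e≈) ⟩
      (a′ + (b′ + d)) + (c + e′) ∎

  Σpart-↭ : ∀ {xs ys} → xs ↭ ys → ∀ f → Invariant f → Σpart xs f ≈ Σpart ys f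
  Σpart-↭ ↭-refl f inv = refl
  Σpart-↭ {x ∷ xs} {x ∷ ys} (prep x xs↭ys) f inv = begin
    Σpart (x ∷ xs) f        ≈⟨ Σpart-∷ x xs f ⟩
    Σpart xs (extend x f)   ≈⟨ Σpart-↭ xs↭ys (extend x f) (extend-invariant x f inv) ⟩
    Σpart ys (extend x f)   ≈⟨ sym (Σpart-∷ x ys f) ⟩
    Σpart (x ∷ ys) f        ∎
  Σpart-↭ {x ∷ y ∷ xs} {y ∷ x ∷ ys} (swap x y xs↭ys) f inv = begin
    Σpart (x ∷ y ∷ xs) f               ≈⟨ trans (Σpart-∷ x (y ∷ xs) f) (Σpart-∷ y xs _) ⟩
    Σpart xs (extend y (extend x f))
      ≈⟨ Σpart-↭ xs↭ys _ (extend-invariant y _ (extend-invariant x f inv)) ⟩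
    Σpart ys (extend y (extend x f))   ≈⟨ Σpart-cong ys (extend-comm x y f inv) ⟩
    Σpart ys (extend x (extend y f))   ≈⟨ sym (trans (Σpart-∷ y (x ∷ ys) f) (Σpart-∷ x ys _)) ⟩
    Σpart (y ∷ x ∷ ys) f               ∎
  Σpart-↭ (↭-trans xs↭zs zs↭ys) f inv = trans (Σpart-↭ xs↭zs f inv) (Σpart-↭ zs↭ys f inv)

  Σinsert-relabel : ∀ g x f p → Σinsert (g x) f (relabel g p) ≈ Σinsert x (f ∘ relabel g) p
  Σinsert-relabel g x f []      = refl
  Σinsert-relabel g x f (b ∷ p) = begin
    Σinsert (g x) f (map g b ∷ relabel g p)
      ≈⟨ Σinsert-∷ (g x) (map g b) (relabel g p) f ⟩
    f ((g x ∷ map g b) ∷ relabel g p) + Σinsert (g x) (λ q → f (map g b ∷ q)) (relabel g p)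
      ≈⟨ +-congˡ (Σinsert-relabel g x (λ q → f (map g b ∷ q)) p) ⟩
    f ((g x ∷ map g b) ∷ relabel g p) + Σinsert x (λ q → f (map g b ∷ relabel g q)) p
      ≈⟨ sym (Σinsert-∷ x b p (f ∘ relabel g)) ⟩
    Σinsert x (f ∘ relabel g) (b ∷ p) ∎

  Σpart-relabel : ∀ g xs f → Σpart (map g xs) f ≈ Σpart xs (f ∘ relabel g)
  Σpart-relabel g []       f = refl
  Σpart-relabel g (x ∷ xs) f = begin
    Σpart (g x ∷ map g xs) f               ≈⟨ Σpart-∷ (g x) (map g xs) f ⟩
    Σpart (map g xs) (extend (g x) f)      ≈⟨ Σpart-relabel g xs _ ⟩
    Σpart xs (extend (g x) f ∘ relabel g)  ≈⟨ Σpart-cong xs (λ p → +-congˡ (Σinsert-relabel g x f p)) ⟩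
    Σpart xs (extend x (f ∘ relabel g))    ≈⟨ sym (Σpart-∷ x xs _) ⟩
    Σpart (x ∷ xs) (f ∘ relabel g)         ∎

  Σinsert-congOn : ∀ (D : ℕ → Set) x p f g → (∀ q → SingletonsIn D q → f q ≈ g q) →
                   SingletonsIn D p → Σinsert x f p ≈ Σinsert x g p
  Σinsert-congOn D x []              f g f≈g _        = refl
  Σinsert-congOn D x ((i ∷ b) ∷ p)   f g f≈g (Di ∷ Dp) = begin
    Σinsert x f ((i ∷ b) ∷ p)                            ≈⟨ Σinsert-∷ x (i ∷ b) p f ⟩
    f ((x ∷ i ∷ b) ∷ p) + Σinsert x (λ q → f ((i ∷ b) ∷ q)) p
      ≈⟨ +-cong (f≈g _ (tt ∷ Dp)) (Σinsert-congOn D x p _ _ (λ q Dq → f≈g _ (Di ∷ Dq)) Dp) ⟩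
    g ((x ∷ i ∷ b) ∷ p) + Σinsert x (λ q → g ((i ∷ b) ∷ q)) p ≈⟨ sym (Σinsert-∷ x (i ∷ b) p g) ⟩
    Σinsert x g ((i ∷ b) ∷ p)                            ∎

  Σpart-congOn : ∀ (D : ℕ → Set) xs f g → All D xs → (∀ p → SingletonsIn D p → f p ≈ g p) →
                 Σpart xs f ≈ Σpart xs g
  Σpart-congOn D []       f g []          f≈g = +-congʳ (f≈g [] [])
  Σpart-congOn D (x ∷ xs) f g (Dx ∷ Dxs) f≈g = begin
    Σpart (x ∷ xs) f    ≈⟨ Σpart-∷ x xs f ⟩
    Σpart xs (extend x f)
      ≈⟨ Σpart-congOn D xs _ _ Dxs (λ p Dp → +-cong (f≈g _ (Dx ∷ Dp)) (Σinsert-congOn D x p f g f≈g Dp)) ⟩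
    Σpart xs (extend x g) ≈⟨ sym (Σpart-∷ x xs g) ⟩
    Σpart (x ∷ xs) g    ∎

module Weights {c ℓ : Level} (R : CommutativeRing c ℓ) (t : ℕ → CommutativeRing.Carrier R) where
  open CommutativeRing R
  open SetoidReasoning setoid
  open PartitionSums R

  -- weightWhen Q P p is w(p) if some singleton of p satisfies Q and all
  -- singletons satisfy P, and 0 otherwise.  With Q = (_≡ᵇ s) and
  -- P = (_≤ᵇ s) this is the summand of A_{n,s-1}.
  weightWhen : (ℕ → Bool) → (ℕ → Bool) → Partition → Carrier
  weightWhen Q P p = if any Q (singletons p) ∧ all P (singletons p) then weight R t p else 0#

  if-cong : ∀ {b b′ : Bool} {x x′ : Carrier} → b ≡ b′ → x ≈ x′ →
            (if b then x else 0#) ≈ (if b′ then x′ else 0#)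
  if-cong {true}  P.refl x≈x′ = x≈x′
  if-cong {false} P.refl x≈x′ = refl

  weight-invariant : Invariant (weight R t)
  weight-invariant (swapBlocks b c p) = begin
    t (length b) * (t (length c) * weight R t p) ≈⟨ x∙yz≈y∙xz _ _ _ ⟩
    t (length c) * (t (length b) * weight R t p) ∎
    where open CommutativeSemigroupProperties *-commutativeSemigroup using (x∙yz≈y∙xz)
  weight-invariant (permuteBlock p b↭c) = *-congʳ (reflexive (P.cong t (↭-length b↭c)))
  weight-invariant (keepBlock b p~q)    = *-congˡ (weight-invariant p~q)

  weightWhen-invariant : ∀ Q P → Invariant (weightWhen Q P)
  weightWhen-invariant Q P p~q =
    if-cong (P.cong₂ _∧_ (any-↭ Q (singletons-~ p~q)) (all-↭ P (singletons-~ p~q))) (weight-invariant p~q)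

  weight-relabel : ∀ g p → weight R t (relabel g p) ≡ weight R t p
  weight-relabel g []      = P.refl
  weight-relabel g (b ∷ p) = P.cong₂ (λ n w → t n * w) (length-map g b) (weight-relabel g p)

  weightWhen-relabel : ∀ Q P g p → weightWhen Q P (relabel g p) ≡ weightWhen (Q ∘ g) (P ∘ g) p
  weightWhen-relabel Q P g p rewrite singletons-relabel g p | weight-relabel g p =
    P.cong (λ b → if b then weight R t p else 0#)
      (P.cong₂ _∧_ (P.cong or (P.sym (map-∘ (singletons p)))) (P.cong and (P.sym (map-∘ (singletons p)))))

  weightWhen-cong : ∀ {Q Q′ P P′} → (∀ i → Q i ≡ Q′ i) → (∀ i → P i ≡ P′ i) →
                    ∀ p → weightWhen Q P p ≡ weightWhen Q′ P′ p
  weightWhen-cong Q≗Q′ P≗P′ p =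
    P.cong (λ b → if b then weight R t p else 0#)
      (P.cong₂ _∧_ (P.cong or (map-cong Q≗Q′ (singletons p))) (P.cong and (map-cong P≗P′ (singletons p))))

  weightWhen-congOn : ∀ {Q Q′ P P′} p → SingletonsIn (Agree Q Q′ P P′) p →
                      weightWhen Q P p ≡ weightWhen Q′ P′ p
  weightWhen-congOn {Q} {Q′} {P} {P′} p agree =
    P.cong (λ b → if b then weight R t p else 0#)
      (P.cong₂ _∧_ (P.cong or (map-cong-local (All.map proj₁ agreeAll)))
                   (P.cong and (map-cong-local (All.map proj₂ agreeAll))))
    where
    agreeAll : All (Agree Q Q′ P P′) (singletons p)
    agreeAll = SingletonsIn⇒All p agree

  weightWhen-newSingleton : ∀ Q P e p → Q e ≡ false →
                            weightWhen Q P ([ e ] ∷ p) ≈ (if P e then t 1 * weightWhen Q P p else 0#)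
  weightWhen-newSingleton Q P e p Qe rewrite Qe with P e
  ... | false rewrite ∧-zeroʳ (any Q (singletons p)) = refl
  ... | true with any Q (singletons p) ∧ all P (singletons p)
  ...   | true  = refl
  ...   | false = sym (zeroʳ _)

is atMost : ℕ → ℕ → Bool
is j i     = i ≡ᵇ j
atMost j i = i ≤ᵇ j

module Layout (s k : ℕ) where
  e σ : ℕ
  e = suc s
  σ = suc e

  below above rest : List ℕ
  below = range 0 s
  above = range σ k
  rest  = below ++ σ ∷ above

  below-≤ : All (_≤ s) below
  below-≤ = range-All (_≤ s) 0 s (λ i _ i≤s → i≤s)

  above-> : All (σ <_) above
  above-> = range-All (σ <_) σ k (λ i σ<i _ → σ<i)

  segment-split : segment (suc (suc (s ℕ.+ k))) ≡ below ++ e ∷ σ ∷ above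
  segment-split = P.trans (segment≡range _) (P.trans (P.cong (range 0) size) (range-++ 0 s (suc (suc k))))
    where
    size : suc (suc (s ℕ.+ k)) ≡ s ℕ.+ suc (suc k)
    size = P.sym (P.trans (+-suc s (suc k)) (P.cong suc (+-suc s k)))

  segment-split′ : segment (suc (s ℕ.+ k)) ≡ below ++ e ∷ range e k
  segment-split′ = P.trans (segment≡range _) (P.trans (P.cong (range 0) (P.sym (+-suc s k))) (range-++ 0 s (suc k)))

  ≤s⇒≢e : ∀ {i} → i ≤ s → i ≢ e
  ≤s⇒≢e i≤s = <⇒≢ (s≤s i≤s)

  ≤s⇒≢σ : ∀ {i} → i ≤ s → i ≢ σ
  ≤s⇒≢σ i≤s = <⇒≢ (s≤s (≤-trans i≤s (n≤1+n s)))

  >σ⇒≢e : ∀ {i} → σ < i → i ≢ e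
  >σ⇒≢e σ<i = >⇒≢ (<-trans (n<1+n e) σ<i)

  >σ⇒≢σ : ∀ {i} → σ < i → i ≢ σ
  >σ⇒≢σ = >⇒≢

  τ : ℕ → ℕ
  τ i = if i ≡ᵇ e then σ else (if i ≡ᵇ σ then e else i)

  τ-e : τ e ≡ σ
  τ-e rewrite ≡ᵇ-refl e = P.refl

  τ-σ : τ σ ≡ e
  τ-σ rewrite ≡ᵇ-false (>⇒≢ (n<1+n e)) | ≡ᵇ-refl σ = P.refl

  τ-other : ∀ {i} → i ≢ e → i ≢ σ → τ i ≡ i
  τ-other {i} i≢e i≢σ rewrite ≡ᵇ-false i≢e | ≡ᵇ-false i≢σ = P.refl

  relabel-swap : map τ (below ++ σ ∷ e ∷ above) ≡ below ++ e ∷ σ ∷ above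
  relabel-swap = P.trans (map-++ τ below (σ ∷ e ∷ above))
    (P.cong₂ _++_ (map-id-local (All.map (λ i≤s → τ-other (≤s⇒≢e i≤s) (≤s⇒≢σ i≤s)) below-≤))
      (P.cong₂ _∷_ τ-σ (P.cong₂ _∷_ τ-e (map-id-local (All.map (λ σ<i → τ-other (>σ⇒≢e σ<i) (>σ⇒≢σ σ<i)) above->)))))

  close : ℕ → ℕ
  close i = if i ≤ᵇ s then i else suc i

  close-≤ : ∀ {i} → i ≤ s → close i ≡ i
  close-≤ i≤s rewrite ≤ᵇ-true i≤s = P.refl

  close-> : ∀ {i} → s < i → close i ≡ suc i
  close-> s<i rewrite ≤ᵇ-false s<i = P.refl

  relabel-close : map close (below ++ e ∷ range e k) ≡ rest
  relabel-close = P.trans (map-++ close below (e ∷ range e k))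
    (P.cong₂ _++_ (map-id-local (All.map close-≤ below-≤))
      (P.cong₂ _∷_ (close-> ≤-refl)
        (P.trans (map-cong-local (range-All _ e k (λ i e<i _ → close-> (<⇒≤ e<i)))) (map-suc-range e k))))

  close-is : ∀ i → is σ (close i) ≡ is e i
  close-is i with i ≤? s
  ... | yes i≤s rewrite close-≤ i≤s = P.trans (≡ᵇ-false (≤s⇒≢σ i≤s)) (P.sym (≡ᵇ-false (≤s⇒≢e i≤s)))
  ... | no  i≰s rewrite close-> (≰⇒> i≰s) = P.refl

  close-atMost : ∀ i → atMost σ (close i) ≡ atMost e i
  close-atMost i with i ≤? s
  ... | yes i≤s rewrite close-≤ i≤s =
    P.trans (≤ᵇ-true (≤-trans i≤s (≤-trans (n≤1+n s) (n≤1+n e)))) (P.sym (≤ᵇ-true (≤-trans i≤s (n≤1+n s))))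
  ... | no  i≰s rewrite close-> (≰⇒> i≰s) = ≤ᵇ-suc i e

  is-σ-e : is σ e ≡ false
  is-σ-e = ≡ᵇ-false (<⇒≢ (n<1+n e))

  atMost-σ-e : atMost σ e ≡ true
  atMost-σ-e = ≤ᵇ-true (n≤1+n e)

  is-e-τe : is e (τ e) ≡ false
  is-e-τe rewrite τ-e = ≡ᵇ-false (>⇒≢ (n<1+n e))

  atMost-e-τe : atMost e (τ e) ≡ false
  atMost-e-τe rewrite τ-e = ≤ᵇ-false (n<1+n e)

  swap-agrees : All (Agree (is e ∘ τ) (is σ) (atMost e ∘ τ) (atMost σ)) rest
  swap-agrees = All-++⁺ (All.map agree-≤ below-≤) (agree-σ ∷ All.map agree-> above->)
    where
    agree-≤ : ∀ {i} → i ≤ s → Agree (is e ∘ τ) (is σ) (atMost e ∘ τ) (atMost σ) i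
    agree-≤ {i} i≤s rewrite τ-other (≤s⇒≢e i≤s) (≤s⇒≢σ i≤s) =
      P.trans (≡ᵇ-false (≤s⇒≢e i≤s)) (P.sym (≡ᵇ-false (≤s⇒≢σ i≤s))) ,
      P.trans (≤ᵇ-true (≤-trans i≤s (n≤1+n s))) (P.sym (≤ᵇ-true (≤-trans i≤s (≤-trans (n≤1+n s) (n≤1+n e)))))
    agree-σ : Agree (is e ∘ τ) (is σ) (atMost e ∘ τ) (atMost σ) σ
    agree-σ rewrite τ-σ = P.trans (≡ᵇ-refl e) (P.sym (≡ᵇ-refl σ)) , P.trans (≤ᵇ-true (≤-refl {e})) (P.sym (≤ᵇ-true (≤-refl {σ})))
    agree-> : ∀ {i} → σ < i → Agree (is e ∘ τ) (is σ) (atMost e ∘ τ) (atMost σ) i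
    agree-> {i} σ<i rewrite τ-other (>σ⇒≢e σ<i) (>σ⇒≢σ σ<i) =
      P.trans (≡ᵇ-false (>σ⇒≢e σ<i)) (P.sym (≡ᵇ-false (>σ⇒≢σ σ<i))) ,
      P.trans (≤ᵇ-false (<-trans (n<1+n e) σ<i)) (P.sym (≤ᵇ-false σ<i))

module Recurrence {c ℓ : Level} (R : CommutativeRing c ℓ) (t : ℕ → CommutativeRing.Carrier R) (s k : ℕ) where
  open CommutativeRing R
  open SetoidReasoning setoid
  open PartitionSums R
  open Weights R t
  open Layout s k

  Fσ Fe : Partition → Carrier
  Fσ = weightWhen (is σ) (atMost σ)
  Fe = weightWhen (is e) (atMost e)

  -- split by whether {e} is a block: t₁ times the partitions of 'rest'
  -- with largest singleton σ, plus those with e in a larger block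
  A-σ-split : A R t (suc (s ℕ.+ k)) (suc s) ≈ t 1 * Σpart rest Fσ + Σpart rest (Σinsert e Fσ)
  A-σ-split = begin
    Σpart (segment (suc (suc (s ℕ.+ k)))) Fσ   ≡⟨ P.cong (λ l → Σpart l Fσ) segment-split ⟩
    Σpart (below ++ e ∷ σ ∷ above) Fσ        ≈⟨ Σpart-↭ (shift e below (σ ∷ above)) Fσ (weightWhen-invariant _ _) ⟩
    Σpart (e ∷ rest) Fσ                      ≈⟨ Σpart-∷ e rest Fσ ⟩
    Σpart rest (extend e Fσ)
      ≈⟨ Σpart-cong rest (λ p → +-congʳ (trans (weightWhen-newSingleton _ _ e p is-σ-e)
            (reflexive (P.cong (λ b → if b then t 1 * Fσ p else 0#) atMost-σ-e)))) ⟩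
    Σpart rest (λ p → t 1 * Fσ p + Σinsert e Fσ p)  ≈⟨ sumOver-+ (setPartitions rest) _ _ ⟩
    Σpart rest (λ p → t 1 * Fσ p) + Σpart rest (Σinsert e Fσ)
      ≈⟨ +-congʳ (sumOver-* (setPartitions rest) _ _) ⟩
    t 1 * Σpart rest Fσ + Σpart rest (Σinsert e Fσ) ∎

  -- exchanging e and σ: partitions with largest singleton e correspond to
  -- partitions with largest singleton σ in which e is not a singleton
  A-e-split : A R t (suc (s ℕ.+ k)) s ≈ Σpart rest (Σinsert e Fσ)
  A-e-split = begin
    Σpart (segment (suc (suc (s ℕ.+ k)))) Fe
      ≡⟨ P.cong (λ l → Σpart l Fe) (P.trans segment-split (P.sym relabel-swap)) ⟩
    Σpart (map τ swapped) Fe                  ≈⟨ Σpart-relabel τ swapped Fe ⟩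
    Σpart swapped (Fe ∘ relabel τ)            ≈⟨ Σpart-cong swapped (reflexive ∘ weightWhen-relabel _ _ τ) ⟩
    Σpart swapped Fτ
      ≈⟨ Σpart-↭ (↭-trans (++⁺ˡ below (swap σ e ↭-refl)) (shift e below (σ ∷ above))) Fτ (weightWhen-invariant _ _) ⟩
    Σpart (e ∷ rest) Fτ                       ≈⟨ Σpart-∷ e rest Fτ ⟩
    Σpart rest (extend e Fτ)
      ≈⟨ Σpart-cong rest (λ p → trans (+-congʳ (trans (weightWhen-newSingleton _ _ e p is-e-τe)
            (reflexive (P.cong (λ b → if b then t 1 * Fτ p else 0#) atMost-e-τe)))) (+-identityˡ _)) ⟩
    Σpart rest (Σinsert e Fτ)
      ≈⟨ Σpart-congOn Agrees rest _ _ swap-agrees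
           (λ p Ap → Σinsert-congOn Agrees e p Fτ Fσ (λ q Aq → reflexive (weightWhen-congOn q Aq)) Ap) ⟩
    Σpart rest (Σinsert e Fσ) ∎
    where
    swapped : List ℕ
    swapped = below ++ σ ∷ e ∷ above
    Fτ : Partition → Carrier
    Fτ = weightWhen (is e ∘ τ) (atMost e ∘ τ)
    Agrees : ℕ → Set
    Agrees = Agree (is e ∘ τ) (is σ) (atMost e ∘ τ) (atMost σ)

  -- closing the gap at e identifies 'rest' with [s+k+1]
  A-close : Σpart rest Fσ ≈ A R t (s ℕ.+ k) s
  A-close = begin
    Σpart rest Fσ                             ≡⟨ P.cong (λ l → Σpart l Fσ) (P.sym relabel-close) ⟩
    Σpart (map close (below ++ e ∷ range e k)) Fσ ≈⟨ Σpart-relabel close (below ++ e ∷ range e k) Fσ ⟩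
    Σpart (below ++ e ∷ range e k) (Fσ ∘ relabel close)
      ≈⟨ Σpart-cong (below ++ e ∷ range e k) (λ p → reflexive (P.trans (weightWhen-relabel (is σ) (atMost σ) close p) (weightWhen-cong close-is close-atMost p))) ⟩
    Σpart (below ++ e ∷ range e k) Fe         ≡⟨ P.cong (λ l → Σpart l Fe) (P.sym segment-split′) ⟩
    A R t (s ℕ.+ k) s ∎

  A-recurrence : A R t (suc (s ℕ.+ k)) (suc s) ≈ A R t (suc (s ℕ.+ k)) s + t 1 * A R t (s ℕ.+ k) s
  A-recurrence = begin
    A R t (suc (s ℕ.+ k)) (suc s)                                  ≈⟨ A-σ-split ⟩
    t 1 * Σpart rest Fσ + Σpart rest (Σinsert e Fσ)               ≈⟨ +-cong (*-congˡ A-close) (sym A-e-split) ⟩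
    t 1 * A R t (s ℕ.+ k) s + A R t (suc (s ℕ.+ k)) s             ≈⟨ +-comm _ _ ⟩
    A R t (suc (s ℕ.+ k)) s + t 1 * A R t (s ℕ.+ k) s ∎

module BinomialSums {c ℓ : Level} (R : CommutativeRing c ℓ) where
  open CommutativeRing R
  open SetoidReasoning setoid
  open SemiringMult semiring using (_×_; ×-homo-+; ×-congˡ; ×-assoc-*)
  open CommutativeSemigroupProperties +-commutativeSemigroup using (interchange)

  sumTo-cong : ∀ n {f g} → (∀ k → k ≤ n → f k ≈ g k) → sumTo R n f ≈ sumTo R n g
  sumTo-cong zero    f≈g = f≈g 0 z≤n
  sumTo-cong (suc n) f≈g =
    +-cong (sumTo-cong n (λ k k≤n → f≈g k (≤-trans k≤n (n≤1+n n)))) (f≈g (suc n) ≤-refl)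

  sumTo-+ : ∀ n f g → sumTo R n (λ k → f k + g k) ≈ sumTo R n f + sumTo R n g
  sumTo-+ zero    f g = refl
  sumTo-+ (suc n) f g = trans (+-congʳ (sumTo-+ n f g)) (interchange _ _ _ _)

  sumTo-* : ∀ n u f → sumTo R n (λ k → u * f k) ≈ u * sumTo R n f
  sumTo-* zero    u f = refl
  sumTo-* (suc n) u f = trans (+-congʳ (sumTo-* n u f)) (sym (distribˡ _ _ _))

  sumTo-suc : ∀ n f → sumTo R (suc n) f ≈ f 0 + sumTo R n (f ∘ suc)
  sumTo-suc zero    f = refl
  sumTo-suc (suc n) f = trans (+-congʳ (sumTo-suc n f)) (+-assoc _ _ _)

  •≡× : ∀ n x → _•_ R n x ≡ n × x
  •≡× zero    x = P.refl
  •≡× (suc n) x = P.cong (x +_) (•≡× n x)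

  •-*-assoc : ∀ n x p → _•_ R n x * p ≈ n × (x * p)
  •-*-assoc n x p = trans (*-congʳ (reflexive (•≡× n x))) (×-assoc-* n x p)

  binomialSum : ℕ → (ℕ → Carrier) → Carrier
  binomialSum n h = sumTo R n (λ k → (n C k) × h k)

  -- Pascal's rule C(n+1,k+1) = C(n,k) + C(n,k+1), summed
  binomialSum-pascal : ∀ n h → binomialSum (suc n) h ≈ binomialSum n h + binomialSum n (h ∘ suc)
  binomialSum-pascal n h = begin
    binomialSum (suc n) h                                         ≈⟨ sumTo-suc n _ ⟩
    1 × h 0 + sumTo R n (λ k → (suc n C suc k) × h (suc k))
      ≈⟨ +-congˡ (sumTo-cong n (λ k _ → trans (×-congˡ (P.sym (nCk+nC[k+1]≡[n+1]C[k+1] n k))) (×-homo-+ _ (n C k) (n C suc k)))) ⟩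
    1 × h 0 + sumTo R n (λ k → (n C k) × h (suc k) + (n C suc k) × h (suc k))
      ≈⟨ +-congˡ (sumTo-+ n _ _) ⟩
    1 × h 0 + (binomialSum n (h ∘ suc) + sumTo R n (λ k → (n C suc k) × h (suc k)))
      ≈⟨ trans (+-congˡ (+-comm _ _)) (sym (+-assoc _ _ _)) ⟩
    ((n C 0) × h 0 + sumTo R n (λ k → (n C suc k) × h (suc k))) + binomialSum n (h ∘ suc)
      ≈⟨ +-congʳ (sym (sumTo-suc n (λ k → (n C k) × h k))) ⟩
    (binomialSum n h + (n C suc n) × h (suc n)) + binomialSum n (h ∘ suc)
      ≈⟨ +-congʳ (trans (+-congˡ (×-congˡ (k>n⇒nCk≡0 {n} {suc n} ≤-refl))) (+-identityʳ _)) ⟩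
    binomialSum n h + binomialSum n (h ∘ suc) ∎

module BinomialTransform {c ℓ : Level} (R : CommutativeRing c ℓ) where
  open CommutativeRing R
  open SetoidReasoning setoid
  open SemiringMult semiring using (_×_; ×-congʳ; ×-assoc-*; ×-comm-*)
  open CommutativeMonoidMult +-commutativeMonoid using (×-distrib-+)
  open CommutativeSemigroupProperties *-commutativeSemigroup using (x∙yz≈y∙xz)
  open BinomialSums R

  pow : Carrier → ℕ → Carrier
  pow = _^_ R

  PascalRecurrence : (ℕ → ℕ → Carrier) → Carrier → Set ℓ
  PascalRecurrence F u = ∀ a N → a ≤ N → F (suc N) (suc a) ≈ F (suc N) a + u * F N a

  module _ (F : ℕ → ℕ → Carrier) (u y : Carrier) (recurrence : PascalRecurrence F u) where

    H K : ℕ → ℕ → ℕ → Carrier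
    H n a c = binomialSum n (λ k → F (n ℕ.+ c) (a ℕ.+ k) * pow y k)
    K n a c = binomialSum n (λ k → (F (c ℕ.+ k) a * pow (y + 1#) k) * pow (y * u) (n ∸ k))

    H-pascal : ∀ n a c → H (suc n) a c ≈ H n a (suc c) + y * H n (suc a) (suc c)
    H-pascal n a c = begin
      H (suc n) a c ≈⟨ binomialSum-pascal n _ ⟩
      binomialSum n (λ k → F (suc n ℕ.+ c) (a ℕ.+ k) * pow y k)
        + binomialSum n (λ k → F (suc n ℕ.+ c) (a ℕ.+ suc k) * pow y (suc k))
        ≈⟨ +-cong (sumTo-cong n (λ k _ → ×-congʳ (n C k) (*-congʳ (reflexive (P.cong (λ j → F j (a ℕ.+ k)) (P.sym (+-suc n c)))))))
                  (trans (sumTo-cong n (λ k _ → trans (×-congʳ (n C k) shifted) (sym (×-comm-* (n C k) _ _)))) (sumTo-* n _ _)) ⟩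
      H n a (suc c) + y * H n (suc a) (suc c) ∎
      where
      shifted : ∀ {k} → F (suc n ℕ.+ c) (a ℕ.+ suc k) * pow y (suc k) ≈ y * (F (n ℕ.+ suc c) (suc a ℕ.+ k) * pow y k)
      shifted {k} = trans (reflexive (P.cong₂ (λ i j → F i j * (y * pow y k)) (P.sym (+-suc n c)) (+-suc a k)))
                          (x∙yz≈y∙xz _ _ _)

    K-pascal : ∀ n a c → K (suc n) a c ≈ (y * u) * K n a c + (y + 1#) * K n a (suc c)
    K-pascal n a c = begin
      K (suc n) a c ≈⟨ binomialSum-pascal n _ ⟩
      binomialSum n (λ k → (F (c ℕ.+ k) a * pow (y + 1#) k) * pow (y * u) (suc n ∸ k))
        + binomialSum n (λ k → (F (c ℕ.+ suc k) a * pow (y + 1#) (suc k)) * pow (y * u) (n ∸ k))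
        ≈⟨ +-cong (trans (sumTo-cong n (λ k k≤n → trans (×-congʳ (n C k) (lower k k≤n)) (sym (×-comm-* (n C k) _ _)))) (sumTo-* n _ _))
                  (trans (sumTo-cong n (λ k _ → trans (×-congʳ (n C k) upper) (sym (×-comm-* (n C k) _ _)))) (sumTo-* n _ _)) ⟩
      (y * u) * K n a c + (y + 1#) * K n a (suc c) ∎
      where
      lower : ∀ k → k ≤ n → (F (c ℕ.+ k) a * pow (y + 1#) k) * pow (y * u) (suc n ∸ k)
                            ≈ (y * u) * ((F (c ℕ.+ k) a * pow (y + 1#) k) * pow (y * u) (n ∸ k))
      lower k k≤n = trans (reflexive (P.cong (λ j → (F (c ℕ.+ k) a * pow (y + 1#) k) * pow (y * u) j) (+-∸-assoc 1 k≤n)))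
                          (x∙yz≈y∙xz _ _ _)
      upper : ∀ {k} → (F (c ℕ.+ suc k) a * pow (y + 1#) (suc k)) * pow (y * u) (n ∸ k)
                      ≈ (y + 1#) * ((F (suc c ℕ.+ k) a * pow (y + 1#) k) * pow (y * u) (n ∸ k))
      upper {k} = begin
        (F (c ℕ.+ suc k) a * ((y + 1#) * pow (y + 1#) k)) * pow (y * u) (n ∸ k)
          ≈⟨ *-congʳ (trans (reflexive (P.cong (λ j → F j a * ((y + 1#) * pow (y + 1#) k)) (+-suc c k))) (x∙yz≈y∙xz _ _ _)) ⟩
        ((y + 1#) * (F (suc c ℕ.+ k) a * pow (y + 1#) k)) * pow (y * u) (n ∸ k) ≈⟨ *-assoc _ _ _ ⟩
        (y + 1#) * ((F (suc c ℕ.+ k) a * pow (y + 1#) k) * pow (y * u) (n ∸ k)) ∎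

    K-recurrence : ∀ n a c → a ≤ c → K n (suc a) (suc c) ≈ K n a (suc c) + u * K n a c
    K-recurrence n a c a≤c = begin
      K n (suc a) (suc c)
        ≈⟨ sumTo-cong n (λ k _ → ×-congʳ (n C k) (*-congʳ (*-congʳ (recurrence a (c ℕ.+ k) (≤-trans a≤c (m≤m+n c k)))))) ⟩
      binomialSum n (λ k → ((F (suc c ℕ.+ k) a + u * F (c ℕ.+ k) a) * pow (y + 1#) k) * pow (y * u) (n ∸ k))
        ≈⟨ sumTo-cong n (λ k _ → trans (×-congʳ (n C k) (distribute _ _ _ _ _))
                                  (trans (×-distrib-+ _ _ (n C k)) (+-congˡ (sym (×-comm-* (n C k) _ _))))) ⟩
      sumTo R n (λ k → (n C k) × ((F (suc c ℕ.+ k) a * pow (y + 1#) k) * pow (y * u) (n ∸ k))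
                     + u * ((n C k) × ((F (c ℕ.+ k) a * pow (y + 1#) k) * pow (y * u) (n ∸ k))))
        ≈⟨ trans (sumTo-+ n _ _) (+-congˡ (sumTo-* n _ _)) ⟩
      K n a (suc c) + u * K n a c ∎
      where
      distribute : ∀ X p Y v q → ((X + v * Y) * p) * q ≈ (X * p) * q + v * ((Y * p) * q)
      distribute X p Y v q = begin
        ((X + v * Y) * p) * q          ≈⟨ *-congʳ (distribʳ p X (v * Y)) ⟩
        (X * p + (v * Y) * p) * q      ≈⟨ distribʳ q _ _ ⟩
        (X * p) * q + ((v * Y) * p) * q ≈⟨ +-congˡ (trans (*-congʳ (*-assoc v Y p)) (*-assoc v _ q)) ⟩
        (X * p) * q + v * ((Y * p) * q) ∎

    H≈K : ∀ n a c → a ≤ c → H n a c ≈ K n a c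
    H≈K zero    a c a≤c = ×-congʳ 1 (begin
      F c (a ℕ.+ 0) * 1#      ≈⟨ *-identityʳ _ ⟩
      F c (a ℕ.+ 0)          ≡⟨ P.cong₂ F (P.sym (ℕ-+-identityʳ c)) (ℕ-+-identityʳ a) ⟩
      F (c ℕ.+ 0) a          ≈⟨ sym (trans (*-identityʳ _) (*-identityʳ _)) ⟩
      (F (c ℕ.+ 0) a * 1#) * 1# ∎)
    H≈K (suc n) a c a≤c = begin
      H (suc n) a c                                    ≈⟨ H-pascal n a c ⟩
      H n a (suc c) + y * H n (suc a) (suc c)
        ≈⟨ +-cong (H≈K n a (suc c) (≤-trans a≤c (n≤1+n c))) (*-congˡ (H≈K n (suc a) (suc c) (s≤s a≤c))) ⟩
      K n a (suc c) + y * K n (suc a) (suc c)          ≈⟨ +-congˡ (*-congˡ (K-recurrence n a c a≤c)) ⟩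
      K n a (suc c) + y * (K n a (suc c) + u * K n a c) ≈⟨ collect _ _ ⟩
      (y * u) * K n a c + (y + 1#) * K n a (suc c)     ≈⟨ sym (K-pascal n a c) ⟩
      K (suc n) a c ∎
      where
      collect : ∀ X Y → X + y * (X + u * Y) ≈ (y * u) * Y + (y + 1#) * X
      collect X Y = begin
        X + y * (X + u * Y)           ≈⟨ +-congˡ (distribˡ y X (u * Y)) ⟩
        X + (y * X + y * (u * Y))     ≈⟨ trans (sym (+-assoc _ _ _)) (+-comm _ _) ⟩
        y * (u * Y) + (X + y * X)     ≈⟨ +-cong (sym (*-assoc y u Y)) (trans (+-comm _ _) (+-congˡ (sym (*-identityˡ X)))) ⟩
        (y * u) * Y + (y * X + 1# * X) ≈⟨ +-congˡ (sym (distribʳ X y 1#)) ⟩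
        (y * u) * Y + (y + 1#) * X    ∎

module _ {c ℓ : Level} (R : CommutativeRing c ℓ) (t : ℕ → CommutativeRing.Carrier R) where
  open CommutativeRing R
  open BinomialTransform R using (PascalRecurrence)

  A-pascal : PascalRecurrence (A R t) (t 1)
  A-pascal a N a≤N =
    P.subst (λ M → A R t (suc M) (suc a) ≈ A R t (suc M) a + t 1 * A R t M a)
            (m+[n∸m]≡n a≤N) (Recurrence.A-recurrence R t a (N ∸ a))

open import Data.Nat using (_+_)

-- The corollary is the case a = c = m of the binomial transform of A.
corollary2p8 : {c ℓ : Level} (R : CommutativeRing c ℓ) (t : ℕ → CommutativeRing.Carrier R)
               (y : CommutativeRing.Carrier R) (n m : ℕ) →
               CommutativeRing._≈_ R
                 (sumTo R n (λ k → CommutativeRing._*_ R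
                   (CommutativeRing._*_ R (_•_ R (n C k) (A R t (m + k) m))
                     (_^_ R (CommutativeRing._+_ R y (CommutativeRing.1# R)) k))
                   (_^_ R (CommutativeRing._*_ R y (t 1)) (n ∸ k))))
                 (sumTo R n (λ k → CommutativeRing._*_ R
                   (_•_ R (n C k) (A R t (n + m) (m + k))) (_^_ R y k)))
corollary2p8 R t y n m =
  trans (sumTo-cong n (λ k _ → trans (*-congʳ (•-*-assoc (n C k) _ _)) (×-assoc-* (n C k) _ _)))
    (trans (sym (H≈K (A R t) (t 1) y (A-pascal R t) n m m ≤-refl))
           (sumTo-cong n (λ k _ → sym (•-*-assoc (n C k) _ _))))
  where
  open CommutativeRing R using (trans; sym; *-congʳ; semiring)
  open SemiringMult semiring using (×-assoc-*)
  open BinomialSums R using (sumTo-cong; •-*-assoc)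
  open BinomialTransform R using (H≈K)
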